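{- Let $G=(V,A)$ be a directed graph, $k$ a positive integer, $u\neq v$ vertices of $G$, $T$ a $u$-directed tree in $G$ with $k$ arcs and $T'$ a $v$-directed tree in $G$ with $k$ arcs. If there is a vertex $w\in N^+_G(u)\cap N^+_G(v)$ such that the induced subgraph $G[V\setminus\{u,v\}]$ contains a $w$-directed tree with $k-1$ arcs, then there is a sequence $\langle T=T_0,\ldots,T_\ell=T'\rangle$ of directed trees in $G$, each with $k$ arcs, such that $|A(T_i)\setminus A(T_{i+1})|=|A(T_{i+1})\setminus A(T_i)|=1$ for all $0\le i<\ell$.
   Context: A directed tree is a directed graph whose underlying undirected graph is a tree and in which every vertex except one vertex $r$ has in-degree exactly $1$; $r$ is its root and the tree is called an $r$-directed tree. $N^+_G(x)=\{y\in V : (x,y)\in A\}$ is the set of out-neighbors of $x$. The directed trees in the sequence may have arbitrary roots. -}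

module Defs where

open import Data.Nat using (ℕ; suc)
open import Data.Fin using (Fin)
open import Data.Fin.Properties using () renaming (_≟_ to _≟ᶠ_)
open import Data.Product using (_×_; _,_; ∃; ∃-syntax; proj₁; proj₂)
open import Data.Product.Properties using (≡-dec)
open import Data.List using (List; []; _∷_; length; filter)
open import Data.List.Relation.Unary.Unique.Propositional using (Unique)
open import Relation.Binary.PropositionalEquality using (_≡_; _≢_)
open import Relation.Binary.Definitions using (DecidableEquality)
open import Relation.Nullary using (¬_)
open import Relation.Nullary.Decidable using (¬?)
open import Data.List.Membership.Propositional using (_∈_)
open import Data.List.Relation.Unary.Any using (any?)

record Digraph (n : ℕ) : Set₁ where
  field
    Arc : Fin n → Fin n → Set
open Digraph public

N⁺ : ∀ {n} → Digraph n → Fin n → Fin n → Set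
N⁺ G x y = Arc G x y

_≟ₑ_ : ∀ {n} → DecidableEquality (Fin n × Fin n)
_≟ₑ_ = ≡-dec _≟ᶠ_ _≟ᶠ_

-- A finite subdigraph of a digraph on Fin n: a root vertex, a vertex list
-- and an arc list (duplicate-freeness is demanded in IsDirectedTree).
record SubDigraph (n : ℕ) : Set where
  constructor mkSub
  field
    root  : Fin n
    verts : List (Fin n)
    arcs  : List (Fin n × Fin n)
open SubDigraph public

module _ {n : ℕ} where


  -- Walks in the underlying undirected (multi)graph of a list of arcs,
  -- recording the list of arcs traversed (each in either direction).
  data UWalk (As : List (Fin n × Fin n)) : Fin n → Fin n → List (Fin n × Fin n) → Set where
    nil : ∀ {x} → UWalk As x x []
    fwd : ∀ {x y z es} → (x , y) ∈ As → UWalk As y z es → UWalk As x z ((x , y) ∷ es)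
    bwd : ∀ {x y z es} → (y , x) ∈ As → UWalk As y z es → UWalk As x z ((y , x) ∷ es)

  inDeg : List (Fin n × Fin n) → Fin n → ℕ
  inDeg As x = length (filter (λ e → proj₂ e ≟ᶠ x) As)

  -- T is an r-directed tree (r = root T): its underlying undirected graph is
  -- a tree (connected and without cycles, i.e. no nonempty closed trail), and
  -- every vertex except r has in-degree exactly 1.
  record IsDirectedTree (T : SubDigraph n) : Set where
    field
      verts-unique : Unique (verts T)
      arcs-unique  : Unique (arcs T)
      root∈        : root T ∈ verts T
      src∈         : ∀ {x y} → (x , y) ∈ arcs T → x ∈ verts T
      tgt∈         : ∀ {x y} → (x , y) ∈ arcs T → y ∈ verts T
      connected    : ∀ {y} → y ∈ verts T → ∃[ es ] UWalk (arcs T) (root T) y es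
      acyclic      : ∀ {x es} → UWalk (arcs T) x x es → Unique es → es ≡ []
      indeg-one    : ∀ {x} → x ∈ verts T → x ≢ root T → inDeg (arcs T) x ≡ 1

  record DirectedTreeIn (G : Digraph n) (T : SubDigraph n) : Set where
    field
      isTree : IsDirectedTree T
      inG    : ∀ {x y} → (x , y) ∈ arcs T → Arc G x y

  -- T is a directed tree in the induced subgraph G[V ∖ {u , v}]
  record DirectedTreeAvoiding (G : Digraph n) (u v : Fin n) (T : SubDigraph n) : Set where
    field
      treeInG : DirectedTreeIn G T
      avoid-u : ¬ (u ∈ verts T)
      avoid-v : ¬ (v ∈ verts T)

  arcDiff : SubDigraph n → SubDigraph n → List (Fin n × Fin n)
  arcDiff T T' = filter (λ e → ¬? (any? (e ≟ₑ_) (arcs T'))) (arcs T)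

-- Listing a directed tree arc by arc, so that every arc leaves a vertex reached before and
-- enters a new one, turns it into an arborescence grown leaf by leaf. Two r-directed trees
-- with k arcs are then reconfigurable: follow such a listing of the target, and make each of
-- its arcs (x , y) present at the bottom of the current tree by exchanging it for the current
-- arc into y, or for a leaf when y is not reached yet.
-- Hanging the shared subtree rooted at w from u via (u , w) and from v via (v , w) gives a
-- u-directed and a v-directed tree differing in one arc; T reconfigures to the first, one
-- exchange leads to the second, and the reversed reconfiguration of T′ leads on to T′.
module Submission where

open import Defs
open import Data.Nat using (ℕ; zero; suc; _+_; _∸_; _≤_; _<_; z≤n; s≤s)
open import Data.Nat.Properties using (≤-antisym; +-comm; +-suc; +-identityʳ; 1+n≰n; suc-injective)
open import Data.Fin using (Fin; zero; suc; fromℕ; inject₁)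
open import Data.Fin.Properties using () renaming (_≟_ to _≟ᶠ_)
open import Data.Product using (_×_; _,_; proj₁; proj₂; ∃-syntax; Σ-syntax)
open import Data.Sum using (_⊎_; inj₁; inj₂; reduce)
open import Data.Empty using (⊥-elim)
open import Data.List using (List; []; _∷_; _++_; _ʳ++_; length; filter; map)
open import Data.List.Properties using (length-++; length-++-sucʳ; length-ʳ++; ++-identityʳ; ʳ++-ʳ++)
open import Data.List.Relation.Unary.Any using (here; there; any?)
open import Data.List.Relation.Unary.All using (All; []; _∷_; tabulate) renaming (lookup to All-lookup)
open import Data.List.Relation.Unary.All.Properties using (¬Any⇒All¬)
open import Data.List.Relation.Unary.AllPairs using ([]; _∷_)
open import Data.List.Relation.Unary.Unique.Propositional using (Unique)
import Data.List.Relation.Unary.Unique.Propositional.Properties as Unique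
open import Data.List.Relation.Binary.Subset.Propositional using (_⊆_)
open import Data.List.Membership.Propositional using (_∈_; _∉_; find; lose)
open import Data.List.Membership.Propositional.Properties
  using (∈-map⁺; ∈-map⁻; ∈-filter⁺; ∈-filter⁻; ∈-++⁺ˡ; ∈-++⁺ʳ; ∈-++⁻)
open import Function using (_∘_; id)
open import Relation.Nullary using (¬_; yes; no)
open import Relation.Nullary.Decidable using (_×-dec_; ¬?)
open import Relation.Unary using (Decidable)
open import Relation.Binary.PropositionalEquality
  using (_≡_; _≢_; refl; sym; trans; cong; subst; module ≡-Reasoning)

module _ {A : Set} where

  data Remove (x : A) : List A → List A → Set where
    rm-here  : ∀ {xs} → Remove x (x ∷ xs) xs
    rm-there : ∀ {y xs ys} → Remove x xs ys → Remove x (y ∷ xs) (y ∷ ys)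

  ∈⇒Remove : ∀ {x xs} → x ∈ xs → ∃[ ys ] Remove x xs ys
  ∈⇒Remove (here refl) = _ , rm-here
  ∈⇒Remove (there x∈xs) with ys , rm ← ∈⇒Remove x∈xs = _ , rm-there rm

  Remove-insert : ∀ {x} xs {ys} → Remove x (xs ++ x ∷ ys) (xs ++ ys)
  Remove-insert []       = rm-here
  Remove-insert (_ ∷ xs) = rm-there (Remove-insert xs)

  Remove-++ʳ : ∀ {x xs ys} zs → Remove x xs ys → Remove x (xs ++ zs) (ys ++ zs)
  Remove-++ʳ zs rm-here     = rm-here
  Remove-++ʳ zs (rm-there rm) = rm-there (Remove-++ʳ zs rm)

  Remove-length : ∀ {x xs ys} → Remove x xs ys → length xs ≡ suc (length ys)
  Remove-length rm-here       = refl
  Remove-length (rm-there rm) = cong suc (Remove-length rm)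

  Remove-∈ : ∀ {x xs ys} → Remove x xs ys → x ∈ xs
  Remove-∈ rm-here       = here refl
  Remove-∈ (rm-there rm) = there (Remove-∈ rm)

  Remove-⊆ : ∀ {x xs ys} → Remove x xs ys → ys ⊆ xs
  Remove-⊆ rm-here       e∈ = there e∈
  Remove-⊆ (rm-there rm) (here refl) = here refl
  Remove-⊆ (rm-there rm) (there e∈)  = there (Remove-⊆ rm e∈)

  Remove-∈⁻ : ∀ {x xs ys e} → Remove x xs ys → e ∈ xs → e ≡ x ⊎ e ∈ ys
  Remove-∈⁻ rm-here       (here refl) = inj₁ refl
  Remove-∈⁻ rm-here       (there e∈)  = inj₂ e∈
  Remove-∈⁻ (rm-there rm) (here refl) = inj₂ (here refl)
  Remove-∈⁻ (rm-there rm) (there e∈) with Remove-∈⁻ rm e∈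
  ... | inj₁ e≡x = inj₁ e≡x
  ... | inj₂ e∈ys = inj₂ (there e∈ys)

  Remove-∉ : ∀ {x xs ys} → Unique xs → Remove x xs ys → x ∉ ys
  Remove-∉ (x∉ ∷ _) rm-here       x∈ = All-lookup x∉ x∈ refl
  Remove-∉ (y∉ ∷ u) (rm-there rm) (here refl) = All-lookup y∉ (Remove-∈ rm) refl
  Remove-∉ (_  ∷ u) (rm-there rm) (there x∈)  = Remove-∉ u rm x∈

  Unique-⊆⇒length-≤ : ∀ {xs ys} → Unique xs → xs ⊆ ys → length xs ≤ length ys
  Unique-⊆⇒length-≤ [] _ = z≤n
  Unique-⊆⇒length-≤ {x ∷ xs} (x∉ ∷ u) xs⊆ys with zs , rm ← ∈⇒Remove (xs⊆ys (here refl)) =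
    subst (suc (length xs) ≤_) (sym (Remove-length rm)) (s≤s (Unique-⊆⇒length-≤ u xs⊆zs))
    where
      xs⊆zs : xs ⊆ zs
      xs⊆zs e∈ with Remove-∈⁻ rm (xs⊆ys (there e∈))
      ... | inj₁ refl = ⊥-elim (All-lookup x∉ e∈ refl)
      ... | inj₂ e∈zs = e∈zs

  ⊆-antisym⇒length-≡ : ∀ {xs ys} → Unique xs → Unique ys → xs ⊆ ys → ys ⊆ xs →
                       length xs ≡ length ys
  ⊆-antisym⇒length-≡ uxs uys xs⊆ys ys⊆xs =
    ≤-antisym (Unique-⊆⇒length-≤ uxs xs⊆ys) (Unique-⊆⇒length-≤ uys ys⊆xs)

  length-filter-cong : ∀ {P Q : A → Set} (P? : Decidable P) (Q? : Decidable Q) {xs ys} →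
                       Unique xs → Unique ys → xs ⊆ ys → ys ⊆ xs →
                       (∀ {e} → P e → Q e) → (∀ {e} → Q e → P e) →
                       length (filter P? xs) ≡ length (filter Q? ys)
  length-filter-cong P? Q? uxs uys xs⊆ys ys⊆xs P⇒Q Q⇒P =
    ⊆-antisym⇒length-≡ (Unique.filter⁺ P? uxs) (Unique.filter⁺ Q? uys)
      (λ e∈ → let e∈xs , Pe = ∈-filter⁻ P? e∈ in ∈-filter⁺ Q? (xs⊆ys e∈xs) (P⇒Q Pe))
      (λ e∈ → let e∈ys , Qe = ∈-filter⁻ Q? e∈ in ∈-filter⁺ P? (ys⊆xs e∈ys) (Q⇒P Qe))

  length-filter-≡1 : ∀ {P : A → Set} (P? : Decidable P) {xs f} → Unique xs → f ∈ xs → P f →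
                     (∀ {e} → e ∈ xs → P e → e ≡ f) → length (filter P? xs) ≡ 1
  length-filter-≡1 P? {xs} {f} uxs f∈xs Pf unique-f =
    ⊆-antisym⇒length-≡ (Unique.filter⁺ P? uxs) ([] ∷ []) only-f (λ { (here refl) → ∈-filter⁺ P? f∈xs Pf })
    where
      only-f : filter P? xs ⊆ f ∷ []
      only-f e∈ = let e∈xs , Pe = ∈-filter⁻ P? e∈ in here (unique-f e∈xs Pe)

  length≡suc⇒∃∈ : ∀ {xs : List A} {m} → length xs ≡ suc m → ∃[ x ] x ∈ xs
  length≡suc⇒∃∈ {x ∷ _} _ = x , here refl

module Walks {n : ℕ} {As : List (Fin n × Fin n)} where

  walk-⊆ : ∀ {a b es} → UWalk As a b es → es ⊆ As
  walk-⊆ (fwd e∈ w) (here refl) = e∈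
  walk-⊆ (fwd _ w)  (there f∈)  = walk-⊆ w f∈
  walk-⊆ (bwd e∈ w) (here refl) = e∈
  walk-⊆ (bwd _ w)  (there f∈)  = walk-⊆ w f∈

  walk-mono : ∀ {Bs a b es} → UWalk As a b es → es ⊆ Bs → UWalk Bs a b es
  walk-mono nil       _     = nil
  walk-mono (fwd _ w) es⊆Bs = fwd (es⊆Bs (here refl)) (walk-mono w (λ f∈ → es⊆Bs (there f∈)))
  walk-mono (bwd _ w) es⊆Bs = bwd (es⊆Bs (here refl)) (walk-mono w (λ f∈ → es⊆Bs (there f∈)))

  walk-snoc : ∀ {a b c es} → UWalk As a b es → (b , c) ∈ As → UWalk As a c (es ++ (b , c) ∷ [])
  walk-snoc nil        bc∈ = fwd bc∈ nil
  walk-snoc (fwd e∈ w) bc∈ = fwd e∈ (walk-snoc w bc∈)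
  walk-snoc (bwd e∈ w) bc∈ = bwd e∈ (walk-snoc w bc∈)

  walk-∷ : ∀ {a b es} e → UWalk As a b es → UWalk (e ∷ As) a b es
  walk-∷ e w = walk-mono w (λ f∈ → there (walk-⊆ w f∈))

  Touches : Fin n → Fin n × Fin n → Set
  Touches y e = proj₁ e ≡ y ⊎ proj₂ e ≡ y

  Pendant : Fin n × Fin n → Set
  Pendant e = ∀ {f} → f ∈ As → Touches (proj₂ e) f → f ≡ e

  walk-last-touches : ∀ {a b es} → UWalk As a b es → a ≢ b → ∃[ f ] (f ∈ es × Touches b f)
  walk-last-touches nil a≢b = ⊥-elim (a≢b refl)
  walk-last-touches {b = b} (fwd {x = a} {y = c} _ w) _ with c ≟ᶠ b
  ... | yes refl = (a , c) , here refl , inj₂ refl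
  ... | no c≢b with f , f∈ , t ← walk-last-touches w c≢b = f , there f∈ , t
  walk-last-touches {b = b} (bwd {x = a} {y = c} _ w) _ with c ≟ᶠ b
  ... | yes refl = (c , a) , here refl , inj₁ refl
  ... | no c≢b with f , f∈ , t ← walk-last-touches w c≢b = f , there f∈ , t

  trail-through-pendant : ∀ {a b es x y} → Unique es → UWalk As a b es → Pendant (x , y) →
                          (x , y) ∈ es → a ≡ y ⊎ b ≡ y
  trail-through-pendant _        (fwd _ nil)         _       (here refl) = inj₂ refl
  trail-through-pendant (u ∷ _)  (fwd _ (fwd f∈ _))  pendant (here refl) =
    ⊥-elim (All-lookup u (here refl) (sym (pendant f∈ (inj₁ refl))))
  trail-through-pendant (u ∷ _)  (fwd _ (bwd f∈ _))  pendant (here refl) =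
    ⊥-elim (All-lookup u (here refl) (sym (pendant f∈ (inj₂ refl))))
  trail-through-pendant _        (bwd _ _)           _       (here refl) = inj₁ refl
  trail-through-pendant (u ∷ us) (fwd f∈ w) pendant (there e∈) with trail-through-pendant us w pendant e∈
  ... | inj₁ refl = ⊥-elim (All-lookup u e∈ (pendant f∈ (inj₂ refl)))
  ... | inj₂ b≡y = inj₂ b≡y
  trail-through-pendant (u ∷ us) (bwd f∈ w) pendant (there e∈) with trail-through-pendant us w pendant e∈
  ... | inj₁ refl = ⊥-elim (All-lookup u e∈ (pendant f∈ (inj₁ refl)))
  ... | inj₂ b≡y = inj₂ b≡y

  -- The first arc of the trail leaves y backwards along (x , y); its last arc would have to use it again.
  closed-trail-at-pendant : ∀ {x y es} → x ≢ y → Pendant (x , y) → UWalk As y y es → Unique es → es ≡ []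
  closed-trail-at-pendant _   _       nil        _ = refl
  closed-trail-at-pendant x≢y pendant (fwd f∈ _) _ with refl ← pendant f∈ (inj₁ refl) = ⊥-elim (x≢y refl)
  closed-trail-at-pendant x≢y pendant (bwd f∈ w) (u ∷ _) with refl ← pendant f∈ (inj₂ refl)
    with f , f∈es , t ← walk-last-touches w x≢y =
    ⊥-elim (All-lookup u f∈es (sym (pendant (walk-⊆ w f∈es) t)))

module SimplePaths {n : ℕ} {As : List (Fin n × Fin n)} where
  open import Data.List.Membership.DecPropositional (_≟ᶠ_ {n}) using () renaming (_∈?_ to _∈ᶠ?_)

  data SimplePath : Fin n → Fin n → List (Fin n × Fin n) → List (Fin n) → Set where
    []   : ∀ {x} → SimplePath x x [] (x ∷ [])
    cons : ∀ {x y z es ws} → (x , y) ∈ As → SimplePath y z es ws → x ∉ ws →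
           SimplePath x z ((x , y) ∷ es) (x ∷ ws)

  path-walk : ∀ {x z es ws} → SimplePath x z es ws → UWalk As x z es
  path-walk []             = nil
  path-walk (cons xy∈ p _) = fwd xy∈ (path-walk p)

  start∈path : ∀ {x z es ws} → SimplePath x z es ws → x ∈ ws
  start∈path []           = here refl
  start∈path (cons _ _ _) = here refl

  path-vertices-unique : ∀ {x z es ws} → SimplePath x z es ws → Unique ws
  path-vertices-unique []           = [] ∷ []
  path-vertices-unique (cons _ p x∉) = ¬Any⇒All¬ _ x∉ ∷ path-vertices-unique p

  arc-ends∈path : ∀ {x z es ws a b} → SimplePath x z es ws → (a , b) ∈ es → a ∈ ws × b ∈ ws
  arc-ends∈path (cons _ p _) (here refl) = here refl , there (start∈path p)
  arc-ends∈path (cons _ p _) (there ab∈) with a∈ , b∈ ← arc-ends∈path p ab∈ = there a∈ , there b∈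

  path-avoids-start : ∀ {x z es ws a b} → SimplePath x z es ws → (a , b) ∈ es → b ≢ x
  path-avoids-start (cons _ p x∉) (here refl)  refl = x∉ (start∈path p)
  path-avoids-start (cons _ p x∉) (there ab∈) refl = x∉ (proj₂ (arc-ends∈path p ab∈))

  path-arcs-unique : ∀ {x z es ws} → SimplePath x z es ws → Unique es
  path-arcs-unique []            = []
  path-arcs-unique (cons _ p x∉) =
    tabulate (λ { ab∈ refl → x∉ (proj₁ (arc-ends∈path p ab∈)) }) ∷ path-arcs-unique p

  path-prefix : ∀ {x z es ws p} → SimplePath x z es ws → p ∈ ws →
                ∃[ es′ ] ∃[ ws′ ] (SimplePath x p es′ ws′ × ws′ ⊆ ws)
  path-prefix []            (here refl) = [] , _ , [] , (λ w∈ → w∈)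
  path-prefix (cons _ _ _)  (here refl) = [] , _ , [] , λ { (here refl) → here refl }
  path-prefix (cons xy∈ q x∉) (there p∈) with es′ , ws′ , q′ , ws′⊆ ← path-prefix q p∈ =
    _ , _ , cons xy∈ q′ (λ x∈ → x∉ (ws′⊆ x∈)) , λ { (here refl) → here refl ; (there w∈) → there (ws′⊆ w∈) }

  Cycle : Set
  Cycle = ∃[ x ] ∃[ es ] (UWalk As x x es × Unique es × es ≢ [])

  close-cycle : ∀ {x z es ws} → (z , x) ∈ As → SimplePath x z es ws → Cycle
  close-cycle zx∈ p = _ , _ , fwd zx∈ (path-walk p) ,
    tabulate (λ { zx∈es refl → path-avoids-start p zx∈es refl }) ∷ path-arcs-unique p , λ ()

  -- Following parents backwards from z must revisit a vertex within length Vs steps.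
  parents⇒cycle : (Vs : List (Fin n)) (Q : Fin n → Set) → (∀ {z} → Q z → z ∈ Vs) →
                  (∀ {z} → Q z → ∃[ p ] (Q p × (p , z) ∈ As)) → ∀ {z} → Q z → Cycle
  parents⇒cycle Vs Q Q⊆Vs parent {z} Qz = extend (length Vs) [] (Qz ∷ []) (+-comm (length Vs) 1)
    where
      extend : (fuel : ℕ) → ∀ {c es ws} → SimplePath c z es ws → All Q ws →
               fuel + length ws ≡ suc (length Vs) → Cycle
      extend fuel {ws = ws} q Qws bound with parent (All-lookup Qws (start∈path q))
      ... | p , Qp , pc∈ with p ∈ᶠ? ws | fuel
      ...   | yes p∈ws | _ with _ , _ , q′ , _ ← path-prefix q p∈ws = close-cycle pc∈ q′
      ...   | no p∉ws | zero =
        ⊥-elim (1+n≰n (subst (_≤ length Vs) bound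
          (Unique-⊆⇒length-≤ (path-vertices-unique q) (λ w∈ → Q⊆Vs (All-lookup Qws w∈)))))
      ...   | no p∉ws | suc fuel′ = extend fuel′ (cons pc∈ q p∉ws) (Qp ∷ Qws) (trans (+-suc fuel′ _) bound)

module Arborescences {n : ℕ} (G : Digraph n) where
  open Walks
  open import Data.List.Membership.DecPropositional (_≟ₑ_ {n}) using () renaming (_∈?_ to _∈ₐ?_)
  open import Data.List.Membership.DecPropositional (_≟ᶠ_ {n}) using () renaming (_∈?_ to _∈ᶠ?_)

  Arcs : Set
  Arcs = List (Fin n × Fin n)

  vertices : Fin n → Arcs → List (Fin n)
  vertices r as = r ∷ map proj₂ as

  tree : Fin n → Arcs → SubDigraph n
  tree r as = mkSub r (vertices r as) as

  -- An r-directed tree in G, listed newest arc first: each arc leaves a vertex reached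
  -- by the earlier arcs and enters a new one.
  data Arborescence (r : Fin n) : Arcs → Set where
    ∅    : Arborescence r []
    grow : ∀ {x y as} → Arc G x y → x ∈ vertices r as → y ∉ vertices r as →
           Arborescence r as → Arborescence r ((x , y) ∷ as)

  module _ {r : Fin n} where

    head∈vertices : ∀ {as x y} → (x , y) ∈ as → y ∈ vertices r as
    head∈vertices xy∈ = there (∈-map⁺ proj₂ xy∈)

    vertices-∷ : ∀ {as z} e → z ∈ vertices r as → z ∈ vertices r (e ∷ as)
    vertices-∷ e (here refl) = here refl
    vertices-∷ e (there z∈)  = there (there z∈)

    vertices⁻ : ∀ {as z} → z ∈ vertices r as → z ≡ r ⊎ ∃[ x ] ((x , z) ∈ as)
    vertices⁻ (here refl) = inj₁ refl
    vertices⁻ (there z∈) with (x , _) , xz∈ , refl ← ∈-map⁻ proj₂ z∈ = inj₂ (x , xz∈)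

    tail∈vertices : ∀ {as x y} → Arborescence r as → (x , y) ∈ as → x ∈ vertices r as
    tail∈vertices (grow {x} {y} _ x∈ _ _) (here refl) = vertices-∷ (x , y) x∈
    tail∈vertices (grow {x} {y} _ _ _ t)  (there uv∈) = vertices-∷ (x , y) (tail∈vertices t uv∈)

    arc∈G : ∀ {as x y} → Arborescence r as → (x , y) ∈ as → Arc G x y
    arc∈G (grow g _ _ _) (here refl) = g
    arc∈G (grow _ _ _ t) (there xy∈) = arc∈G t xy∈

    parent-unique : ∀ {as x x′ y} → Arborescence r as → (x , y) ∈ as → (x′ , y) ∈ as → x ≡ x′
    parent-unique (grow _ _ _ _)  (here refl) (here refl) = refl
    parent-unique (grow _ _ y∉ _) (here refl) (there x′y∈) = ⊥-elim (y∉ (head∈vertices x′y∈))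
    parent-unique (grow _ _ y∉ _) (there xy∈) (here refl)  = ⊥-elim (y∉ (head∈vertices xy∈))
    parent-unique (grow _ _ _ t)  (there xy∈) (there x′y∈) = parent-unique t xy∈ x′y∈

    arcs-unique : ∀ {as} → Arborescence r as → Unique as
    arcs-unique ∅ = []
    arcs-unique (grow _ _ y∉ t) = tabulate (λ { xy∈ refl → y∉ (head∈vertices xy∈) }) ∷ arcs-unique t

    vertices-unique : ∀ {as} → Arborescence r as → Unique (vertices r as)
    vertices-unique ∅ = [] ∷ []
    vertices-unique (grow _ _ y∉ t) with r∉ ∷ u ← vertices-unique t =
      ((λ r≡y → y∉ (here (sym r≡y))) ∷ r∉) ∷ ¬Any⇒All¬ _ (y∉ ∘ there) ∷ u

    leaf-pendant : ∀ {as x y} → Arborescence r as → y ∉ vertices r as → Pendant {As = (x , y) ∷ as} (x , y)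
    leaf-pendant _ _  (here refl) _ = refl
    leaf-pendant t y∉ (there f∈) (inj₁ refl) = ⊥-elim (y∉ (tail∈vertices t f∈))
    leaf-pendant t y∉ (there f∈) (inj₂ refl) = ⊥-elim (y∉ (head∈vertices f∈))

    Arborescence-acyclic : ∀ {as a es} → Arborescence r as → UWalk as a a es → Unique es → es ≡ []
    Arborescence-acyclic ∅ nil _ = refl
    Arborescence-acyclic {(x , y) ∷ as} {es = es} (grow _ x∈ y∉ t) w u with (x , y) ∈ₐ? es
    ... | no xy∉es = Arborescence-acyclic t (walk-mono w in-as) u
      where
        in-as : es ⊆ as
        in-as f∈ with walk-⊆ w f∈
        ... | here refl = ⊥-elim (xy∉es f∈)
        ... | there f∈as = f∈as
    ... | yes xy∈es with refl ← reduce (trail-through-pendant u w (leaf-pendant t y∉) xy∈es) =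
      closed-trail-at-pendant (λ { refl → y∉ x∈ }) (leaf-pendant t y∉) w u

    walk-from-root : ∀ {as z} → Arborescence r as → z ∈ vertices r as → ∃[ es ] UWalk as r z es
    walk-from-root _ (here refl) = [] , nil
    walk-from-root (grow {x} {y} _ x∈ _ t) (there (here refl)) with es , w ← walk-from-root t x∈ =
      _ , walk-snoc (walk-∷ (x , y) w) (here refl)
    walk-from-root (grow {x} {y} _ _ _ t) (there (there z∈)) with es , w ← walk-from-root t (there z∈) =
      es , walk-∷ (x , y) w

    in-degree-one : ∀ {as z} → Arborescence r as → z ∈ vertices r as → z ≢ r → inDeg as z ≡ 1
    in-degree-one {as} {z} t z∈ z≢r with vertices⁻ z∈
    ... | inj₁ z≡r = ⊥-elim (z≢r z≡r)
    ... | inj₂ (x , xz∈) = length-filter-≡1 (λ e → proj₂ e ≟ᶠ z) (arcs-unique t) xz∈ refl only-parent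
      where
        only-parent : ∀ {e} → e ∈ as → proj₂ e ≡ z → e ≡ (x , z)
        only-parent {x′ , _} x′z∈ refl = cong (_, z) (parent-unique t x′z∈ xz∈)

    Arborescence⇒DirectedTreeIn : ∀ {as} → Arborescence r as → DirectedTreeIn G (tree r as)
    Arborescence⇒DirectedTreeIn t = record
      { isTree = record
        { verts-unique = vertices-unique t
        ; arcs-unique  = arcs-unique t
        ; root∈        = here refl
        ; src∈         = tail∈vertices t
        ; tgt∈         = head∈vertices
        ; connected    = walk-from-root t
        ; acyclic      = Arborescence-acyclic t
        ; indeg-one    = in-degree-one t
        }
      ; inG = arc∈G t
      }

  module _ (T : SubDigraph n) (D : DirectedTreeIn G T) where
    open DirectedTreeIn D using (inG)
    open IsDirectedTree (DirectedTreeIn.isTree D) using (root∈; src∈; tgt∈; acyclic; indeg-one)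
    open SimplePaths {As = arcs T}

    Closed : Arcs → Set
    Closed as = ∀ {x y} → (x , y) ∈ arcs T → x ∈ vertices (root T) as → y ∈ vertices (root T) as

    Leaving : Arcs → Fin n × Fin n → Set
    Leaving as e = proj₁ e ∈ vertices (root T) as × proj₂ e ∉ vertices (root T) as

    Leaving? : ∀ as → Decidable (Leaving as)
    Leaving? as e = (proj₁ e ∈ᶠ? vertices _ as) ×-dec ¬? (proj₂ e ∈ᶠ? vertices _ as)

    grow-maximal : (fuel : ℕ) → ∀ {as} → Arborescence (root T) as → as ⊆ arcs T →
                   fuel + length as ≡ length (arcs T) →
                   ∃[ bs ] (Arborescence (root T) bs × bs ⊆ arcs T × Closed bs)
    grow-maximal fuel {as} t as⊆ bound with any? (Leaving? as) (arcs T)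
    ... | no none-leaving = as , t , as⊆ , closed
      where
        closed : Closed as
        closed {y = y} xy∈ x∈ with y ∈ᶠ? vertices _ as
        ... | yes y∈ = y∈
        ... | no y∉ = ⊥-elim (none-leaving (lose xy∈ (x∈ , y∉)))
    ... | yes leaving with (x , y) , xy∈ , x∈ , y∉ ← find leaving = continue fuel bound
      where
        t′ : Arborescence (root T) ((x , y) ∷ as)
        t′ = grow (inG xy∈) x∈ y∉ t
        t′⊆ : (x , y) ∷ as ⊆ arcs T
        t′⊆ (here refl) = xy∈
        t′⊆ (there e∈)  = as⊆ e∈
        continue : ∀ fuel → fuel + length as ≡ length (arcs T) →
                   ∃[ bs ] (Arborescence (root T) bs × bs ⊆ arcs T × Closed bs)
        continue zero      bound = ⊥-elim (1+n≰n (subst (length as <_) (sym bound)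
                                     (Unique-⊆⇒length-≤ (arcs-unique t′) t′⊆)))
        continue (suc fuel′) bound = grow-maximal fuel′ t′ t′⊆ (trans (+-suc fuel′ _) bound)

    in-arc : ∀ {y} → y ∈ verts T → y ≢ root T → ∃[ x ] ((x , y) ∈ arcs T)
    in-arc {y} y∈ y≢r
      with (x , _) , e∈ ← length≡suc⇒∃∈ {xs = filter (λ e → proj₂ e ≟ᶠ y) (arcs T)} (indeg-one y∈ y≢r)
      with xy∈ , refl ← ∈-filter⁻ (λ e → proj₂ e ≟ᶠ y) {xs = arcs T} e∈ = x , xy∈

    in-arc-unique : ∀ {x x′ y} → (x , y) ∈ arcs T → (x′ , y) ∈ arcs T → y ≢ root T → x ≡ x′
    in-arc-unique {x} {x′} {y} xy∈ x′y∈ y≢r with x ≟ᶠ x′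
    ... | yes x≡x′ = x≡x′
    ... | no x≢x′ = ⊥-elim (1+n≰n (subst (2 ≤_) (indeg-one (tgt∈ xy∈) y≢r)
                      (Unique-⊆⇒length-≤ ((x≢x′ ∘ cong proj₁ ∷ []) ∷ [] ∷ []) both∈)))
      where
        both∈ : (x , y) ∷ (x′ , y) ∷ [] ⊆ filter (λ e → proj₂ e ≟ᶠ y) (arcs T)
        both∈ (here refl)         = ∈-filter⁺ (λ e → proj₂ e ≟ᶠ y) xy∈ refl
        both∈ (there (here refl)) = ∈-filter⁺ (λ e → proj₂ e ≟ᶠ y) x′y∈ refl

    no-cycle : ¬ Cycle
    no-cycle (_ , _ , w , u , es≢[]) = es≢[] (acyclic w u)

    module _ {as} (t : Arborescence (root T) as) (as⊆ : as ⊆ arcs T) (closed : Closed as) where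

      -- By closedness a vertex outside has its parent outside too; following parents gives a cycle.
      verts⊆vertices : verts T ⊆ vertices (root T) as
      verts⊆vertices {z} z∈ with z ∈ᶠ? vertices _ as
      ... | yes z∈′ = z∈′
      ... | no z∉ = ⊥-elim (no-cycle (parents⇒cycle (verts T) Outside proj₁ parent (z∈ , z∉)))
        where
          Outside : Fin n → Set
          Outside u = u ∈ verts T × u ∉ vertices (root T) as
          parent : ∀ {u} → Outside u → ∃[ p ] (Outside p × (p , u) ∈ arcs T)
          parent (u∈ , u∉) with p , pu∈ ← in-arc u∈ (λ u≡r → u∉ (here u≡r)) =
            p , (src∈ pu∈ , λ p∈ → u∉ (closed pu∈ p∈)) , pu∈

      -- An arc into the root would close a cycle with the path from the root to its tail.
      arcs⊆as : arcs T ⊆ as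
      arcs⊆as {x , y} xy∈ with y ≟ᶠ root T
      ... | yes refl = ⊥-elim (no-cycle
            (parents⇒cycle (vertices _ as) (_∈ vertices _ as) id parent (verts⊆vertices (src∈ xy∈))))
        where
          parent : ∀ {u} → u ∈ vertices (root T) as → ∃[ p ] (p ∈ vertices (root T) as × (p , u) ∈ arcs T)
          parent u∈ with vertices⁻ u∈
          ... | inj₁ refl      = x , verts⊆vertices (src∈ xy∈) , xy∈
          ... | inj₂ (p , pu∈) = p , tail∈vertices t pu∈ , as⊆ pu∈
      ... | no y≢r with vertices⁻ (verts⊆vertices (tgt∈ xy∈))
      ...   | inj₁ y≡r = ⊥-elim (y≢r y≡r)
      ...   | inj₂ (p , py∈) = subst (_∈ as) (cong (_, y) (sym (in-arc-unique xy∈ (as⊆ py∈) y≢r))) py∈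

    DirectedTreeIn⇒Arborescence : ∃[ as ] (Arborescence (root T) as × as ⊆ arcs T × arcs T ⊆ as)
    DirectedTreeIn⇒Arborescence with as , t , as⊆ , closed ← grow-maximal (length (arcs T)) ∅ (λ ()) (+-identityʳ _) =
      as , t , as⊆ , arcs⊆as t as⊆ closed

    vertices⊆verts : ∀ {as} → as ⊆ arcs T → vertices (root T) as ⊆ verts T
    vertices⊆verts as⊆ z∈ with vertices⁻ z∈
    ... | inj₁ refl      = root∈
    ... | inj₂ (_ , xz∈) = tgt∈ (as⊆ xz∈)

  module _ {r : Fin n} where

    vertices-mono : ∀ {as bs} → as ⊆ bs → vertices r as ⊆ vertices r bs
    vertices-mono as⊆bs z∈ with vertices⁻ z∈
    ... | inj₁ refl      = here refl
    ... | inj₂ (_ , xz∈) = head∈vertices (as⊆bs xz∈)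

    vertices-Remove⁻ : ∀ {e as bs z} → Remove e bs as → z ∈ vertices r bs → z ∈ vertices r as ⊎ z ≡ proj₂ e
    vertices-Remove⁻ rm z∈ with vertices⁻ z∈
    ... | inj₁ refl = inj₁ (here refl)
    ... | inj₂ (_ , xz∈) with Remove-∈⁻ rm xz∈
    ...   | inj₁ refl = inj₂ refl
    ...   | inj₂ xz∈as = inj₁ (head∈vertices xz∈as)

    Arborescence-ʳ++⁻ : ∀ Bs {P} → Arborescence r (Bs ʳ++ P) → Arborescence r P
    Arborescence-ʳ++⁻ []       t = t
    Arborescence-ʳ++⁻ (_ ∷ Bs) t with grow _ _ _ t′ ← Arborescence-ʳ++⁻ Bs t = t′

    insert-above : ∀ R {P x y} → Arborescence r (R ++ P) → Arc G x y → x ∈ vertices r P →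
                   y ∉ vertices r (R ++ P) → Arborescence r (R ++ (x , y) ∷ P)
    insert-above []            t                  g x∈ y∉ = grow g x∈ y∉ t
    insert-above ((a , b) ∷ R) (grow g′ a∈ b∉ t) g x∈ y∉ =
      grow g′ (vertices-mono (Remove-⊆ (Remove-insert R)) a∈) b∉′ (insert-above R t g x∈ (y∉ ∘ vertices-∷ (a , b)))
      where
        b∉′ : b ∉ vertices r (R ++ _ ∷ _)
        b∉′ b∈ with vertices-Remove⁻ (Remove-insert R) b∈
        ... | inj₁ b∈′ = b∉ b∈′
        ... | inj₂ refl = y∉ (there (here refl))

    -- The subtree below y now hangs from x instead of z.
    reattach : ∀ {R R′ P x y z} → Remove (z , y) R R′ → Arborescence r (R ++ P) → Arc G x y →
               x ∈ vertices r P → y ∉ vertices r P → Arborescence r (R′ ++ (x , y) ∷ P)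
    reattach {R′ = R′} rm-here (grow _ _ y∉ t) g x∈ _ = insert-above R′ t g x∈ y∉
    reattach {R′ = (a , b) ∷ R′} {P} {x} {y} (rm-there rm) (grow g′ a∈ b∉ t) g x∈ y∉ =
      grow g′ a∈′ b∉′ (reattach rm t g x∈ y∉)
      where
        a∈′ : a ∈ vertices r (R′ ++ (x , y) ∷ P)
        a∈′ with vertices-Remove⁻ (Remove-++ʳ P rm) a∈
        ... | inj₁ a∈R′P = vertices-mono (Remove-⊆ (Remove-insert R′)) a∈R′P
        ... | inj₂ refl  = head∈vertices (Remove-∈ (Remove-insert R′))
        b∉′ : b ∉ vertices r (R′ ++ (x , y) ∷ P)
        b∉′ b∈ with vertices-Remove⁻ (Remove-insert R′) b∈
        ... | inj₁ b∈R′P = b∉ (vertices-mono (Remove-⊆ (Remove-++ʳ P rm)) b∈R′P)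
        ... | inj₂ refl  = b∉ (head∈vertices (∈-++⁺ˡ (Remove-∈ rm)))

    -- Removing one arc of R (a leaf, or the arc into y) makes room for (x , y) on top of P.
    make-room : ∀ {f R P x y} → Arborescence r (f ∷ R ++ P) → Arc G x y → x ∈ vertices r P → y ∉ vertices r P →
                ∃[ g ] ∃[ R′ ] (Remove g (f ∷ R) R′ × Arborescence r (R′ ++ (x , y) ∷ P))
    make-room {f} {R} {P} {x} {y} t g x∈ y∉ with y ∈ᶠ? vertices r (f ∷ R ++ P)
    ... | no y∉′ with grow _ _ _ t′ ← t = f , R , rm-here , insert-above R t′ g x∈ (y∉′ ∘ vertices-∷ f)
    ... | yes y∈ with vertices⁻ y∈
    ...   | inj₁ refl = ⊥-elim (y∉ (here refl))
    ...   | inj₂ (z , zy∈) with ∈-++⁻ (f ∷ R) zy∈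
    ...     | inj₂ zy∈P = ⊥-elim (y∉ (head∈vertices zy∈P))
    ...     | inj₁ zy∈R with R′ , rm ← ∈⇒Remove zy∈R = (z , y) , R′ , rm , reattach rm t g x∈ y∉

  extend-root : ∀ {w s u} → Arborescence w s → u ∉ vertices w s → Arc G u w →
                Arborescence u (s ++ (u , w) ∷ [])
  extend-root ∅ u∉ g = grow g (here refl) (λ { (here w≡u) → u∉ (here (sym w≡u)) ; (there ()) }) ∅
  extend-root {w} {(a , b) ∷ s} {u} (grow g′ a∈ b∉ t) u∉ g =
    grow g′ (moved a∈) b∉′ (extend-root t (u∉ ∘ vertices-∷ (a , b)) g)
    where
      moved : ∀ {z} → z ∈ vertices w s → z ∈ vertices u (s ++ (u , w) ∷ [])
      moved z∈ with vertices⁻ z∈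
      ... | inj₁ refl      = head∈vertices (∈-++⁺ʳ s (here refl))
      ... | inj₂ (_ , xz∈) = head∈vertices (∈-++⁺ˡ xz∈)
      b∉′ : b ∉ vertices u (s ++ (u , w) ∷ [])
      b∉′ b∈ with vertices⁻ b∈
      ... | inj₁ refl = u∉ (there (here refl))
      ... | inj₂ (_ , xb∈) with ∈-++⁻ s xb∈
      ...   | inj₁ xb∈s        = b∉ (head∈vertices xb∈s)
      ...   | inj₂ (here refl) = b∉ (here refl)

module Reconfiguration {n : ℕ} (G : Digraph n) (k : ℕ) where
  open Arborescences G

  record KTree : Set where
    field
      sub    : SubDigraph n
      treeIn : DirectedTreeIn G sub
      size   : length (arcs sub) ≡ k
  open KTree

  KTree-unique : (X : KTree) → Unique (arcs (sub X))
  KTree-unique X = IsDirectedTree.arcs-unique (DirectedTreeIn.isTree (treeIn X))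

  record _≈_ (X Y : KTree) : Set where
    constructor _,_
    field
      ⊆-to   : arcs (sub X) ⊆ arcs (sub Y)
      ⊆-from : arcs (sub Y) ⊆ arcs (sub X)

  ≈-sym : ∀ {X Y} → X ≈ Y → Y ≈ X
  ≈-sym (X⊆Y , Y⊆X) = Y⊆X , X⊆Y

  ≈-refl : ∀ {X} → X ≈ X
  ≈-refl = (λ e∈ → e∈) , (λ e∈ → e∈)

  ≈-trans : ∀ {X Y Z} → X ≈ Y → Y ≈ Z → X ≈ Z
  ≈-trans (X⊆Y , Y⊆X) (Y⊆Z , Z⊆Y) = Y⊆Z ∘ X⊆Y , Y⊆X ∘ Z⊆Y

  record Step (X Y : KTree) : Set where
    constructor _,_
    field
      one-removed : length (arcDiff (sub X) (sub Y)) ≡ 1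
      one-added   : length (arcDiff (sub Y) (sub X)) ≡ 1

  Step-sym : ∀ {X Y} → Step X Y → Step Y X
  Step-sym (removed , added) = added , removed

  arcDiff-cong : ∀ {X X′ Y Y′} → X ≈ X′ → Y ≈ Y′ →
                 length (arcDiff (sub X) (sub Y)) ≡ length (arcDiff (sub X′) (sub Y′))
  arcDiff-cong {X} {X′} {Y} {Y′} (X⊆X′ , X′⊆X) (Y⊆Y′ , Y′⊆Y) =
    length-filter-cong (λ e → ¬? (any? (e ≟ₑ_) (arcs (sub Y)))) (λ e → ¬? (any? (e ≟ₑ_) (arcs (sub Y′))))
      (KTree-unique X) (KTree-unique X′) X⊆X′ X′⊆X (λ e∉Y → e∉Y ∘ Y′⊆Y) (λ e∉Y′ → e∉Y′ ∘ Y⊆Y′)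

  Step-respˡ : ∀ {X X′ Y} → X′ ≈ X → Step X Y → Step X′ Y
  Step-respˡ {Y = Y} X′≈X (removed , added) =
    trans (arcDiff-cong X′≈X (≈-refl {Y})) removed , trans (arcDiff-cong (≈-refl {Y}) X′≈X) added

  Step-respʳ : ∀ {X Y Y′} → Y ≈ Y′ → Step X Y → Step X Y′
  Step-respʳ Y≈Y′ = Step-sym ∘ Step-respˡ (≈-sym Y≈Y′) ∘ Step-sym

  exchange-arc : ∀ {a b zs X Y} → Remove a (arcs (sub X)) zs → Remove b (arcs (sub Y)) zs → a ≢ b → Step X Y
  exchange-arc {X = X} {Y} rmX rmY a≢b =
    only-one-not-in (KTree-unique X) rmX rmY a≢b , only-one-not-in (KTree-unique Y) rmY rmX (a≢b ∘ sym)
    where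
      only-one-not-in : ∀ {a b xs ys zs} → Unique xs → Remove a xs zs → Remove b ys zs → a ≢ b →
                        length (filter (λ e → ¬? (any? (e ≟ₑ_) ys)) xs) ≡ 1
      only-one-not-in {a} {b} {xs} {ys} uxs rmX rmY a≢b =
        length-filter-≡1 (λ e → ¬? (any? (e ≟ₑ_) ys)) uxs (Remove-∈ rmX) a∉ys only-a
        where
          a∉ys : a ∉ ys
          a∉ys a∈ys with Remove-∈⁻ rmY a∈ys
          ... | inj₁ a≡b  = a≢b a≡b
          ... | inj₂ a∈zs = Remove-∉ uxs rmX a∈zs
          only-a : ∀ {e} → e ∈ xs → e ∉ ys → e ≡ a
          only-a e∈xs e∉ys with Remove-∈⁻ rmX e∈xs
          ... | inj₁ e≡a  = e≡a
          ... | inj₂ e∈zs = ⊥-elim (e∉ys (Remove-⊆ rmY e∈zs))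

  exchange-same-arc : ∀ {a zs X Y} → Remove a (arcs (sub X)) zs → Remove a (arcs (sub Y)) zs → X ≈ Y
  exchange-same-arc rmX rmY = from rmX rmY , from rmY rmX
    where
      from : ∀ {a xs ys zs} → Remove a xs zs → Remove a ys zs → xs ⊆ ys
      from rmX rmY e∈ with Remove-∈⁻ rmX e∈
      ... | inj₁ refl = Remove-∈ rmY
      ... | inj₂ e∈zs = Remove-⊆ rmY e∈zs

  -- Reconfiguration up to _≈_: trees with the same arcs may still differ in their vertex lists.
  infixr 5 _∷_
  data _⇝_ : KTree → KTree → Set where
    [_] : ∀ {X Y} → X ≈ Y → X ⇝ Y
    _∷_ : ∀ {X Y Z} → Step X Y → Y ⇝ Z → X ⇝ Z

  ⇝-respˡ : ∀ {X X′ Z} → X′ ≈ X → X ⇝ Z → X′ ⇝ Z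
  ⇝-respˡ X′≈X [ X≈Z ]   = [ ≈-trans X′≈X X≈Z ]
  ⇝-respˡ X′≈X (s ∷ Y⇝Z) = Step-respˡ X′≈X s ∷ Y⇝Z

  ⇝-trans : ∀ {X Y Z} → X ⇝ Y → Y ⇝ Z → X ⇝ Z
  ⇝-trans [ X≈Y ]   Y⇝Z = ⇝-respˡ X≈Y Y⇝Z
  ⇝-trans (s ∷ X⇝Y) Y⇝Z = s ∷ ⇝-trans X⇝Y Y⇝Z

  ⇝-sym : ∀ {X Y} → X ⇝ Y → Y ⇝ X
  ⇝-sym [ X≈Y ]   = [ ≈-sym X≈Y ]
  ⇝-sym (s ∷ X⇝Y) = ⇝-trans (⇝-sym X⇝Y) (Step-sym s ∷ [ ≈-refl ])

  exchange : ∀ {a b zs X Y Z} → Remove a (arcs (sub X)) zs → Remove b (arcs (sub Y)) zs → Y ⇝ Z → X ⇝ Z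
  exchange {a} {b} rmX rmY Y⇝Z with a ≟ₑ b
  ... | yes refl = ⇝-respˡ (exchange-same-arc rmX rmY) Y⇝Z
  ... | no a≢b   = exchange-arc rmX rmY a≢b ∷ Y⇝Z

  Reconfiguration : SubDigraph n → SubDigraph n → Set
  Reconfiguration T T′ =
    ∃[ ℓ ] Σ[ Ts ∈ (Fin (suc ℓ) → SubDigraph n) ]
      ((Ts zero ≡ T) × (Ts (fromℕ ℓ) ≡ T′) ×
       (∀ i → DirectedTreeIn G (Ts i) × length (arcs (Ts i)) ≡ k) ×
       (∀ (i : Fin ℓ) → length (arcDiff (Ts (inject₁ i)) (Ts (suc i))) ≡ 1
                      × length (arcDiff (Ts (suc i)) (Ts (inject₁ i))) ≡ 1))

  reconfiguration-[] : (X : KTree) → Reconfiguration (sub X) (sub X)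
  reconfiguration-[] X = 0 , (λ _ → sub X) , refl , refl , (λ _ → treeIn X , size X) , λ ()

  reconfiguration-∷ : (X : KTree) {Y : KTree} {T′ : SubDigraph n} → Step X Y → Reconfiguration (sub Y) T′ →
                      Reconfiguration (sub X) T′
  reconfiguration-∷ X (removed , added) (ℓ , Ts , refl , last , trees , steps) =
    suc ℓ , Ts′ , refl , last , trees′ , steps′
    where
      Ts′ : Fin (suc (suc ℓ)) → SubDigraph n
      Ts′ zero    = sub X
      Ts′ (suc i) = Ts i
      trees′ : ∀ i → DirectedTreeIn G (Ts′ i) × length (arcs (Ts′ i)) ≡ k
      trees′ zero    = treeIn X , size X
      trees′ (suc i) = trees i
      steps′ : ∀ (i : Fin (suc ℓ)) → length (arcDiff (Ts′ (inject₁ i)) (Ts′ (suc i))) ≡ 1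
                                    × length (arcDiff (Ts′ (suc i)) (Ts′ (inject₁ i))) ≡ 1
      steps′ zero    = removed , added
      steps′ (suc i) = steps i

  step-⇝⇒reconfiguration : ∀ {X Y Z} → Step X Y → Y ⇝ Z → Reconfiguration (sub X) (sub Z)
  step-⇝⇒reconfiguration {X} {Z = Z} s [ Y≈Z ] = reconfiguration-∷ X (Step-respʳ Y≈Z s) (reconfiguration-[] Z)
  step-⇝⇒reconfiguration {X} s (s′ ∷ Y⇝Z) = reconfiguration-∷ X s (step-⇝⇒reconfiguration s′ Y⇝Z)

  -- The step in the middle is what lets both ends be matched exactly rather than up to _≈_.
  ⇝-step-⇝⇒reconfiguration : ∀ {X Y Y′ Z} → X ⇝ Y → Step Y Y′ → Y′ ⇝ Z → Reconfiguration (sub X) (sub Z)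
  ⇝-step-⇝⇒reconfiguration [ X≈Y ]   s Y′⇝Z = step-⇝⇒reconfiguration (Step-respˡ X≈Y s) Y′⇝Z
  ⇝-step-⇝⇒reconfiguration {X} (s₀ ∷ X⇝Y) s Y′⇝Z = reconfiguration-∷ X s₀ (⇝-step-⇝⇒reconfiguration X⇝Y s Y′⇝Z)

  arborescence : ∀ {r as} → Arborescence r as → length as ≡ k → KTree
  arborescence {r} {as} t l = record { sub = tree r as ; treeIn = Arborescence⇒DirectedTreeIn t ; size = l }

  ≡⇒≈ : ∀ {X Y} → arcs (sub X) ≡ arcs (sub Y) → X ≈ Y
  ≡⇒≈ eq = (λ e∈ → subst (_ ∈_) eq e∈) , (λ e∈ → subst (_ ∈_) (sym eq) e∈)

  -- R ++ P is turned into Bs ʳ++ P one arc of Bs at a time, so that the common part P grows.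
  converge : ∀ {r} Bs P R (tR : Arborescence r (R ++ P)) (tB : Arborescence r (Bs ʳ++ P))
             (lR : length (R ++ P) ≡ k) (lB : length (Bs ʳ++ P) ≡ k) → length R ≡ length Bs →
             arborescence tR lR ⇝ arborescence tB lB
  converge []       P []      _ _ _ _ _  = [ ≡⇒≈ refl ]
  converge (_ ∷ _)  P []      _ _ _ _ ()
  converge []       P (_ ∷ _) _ _ _ _ ()
  converge ((x , y) ∷ Bs) P (f ∷ R) tR tB lR lB len
    with grow g x∈ y∉ _ ← Arborescence-ʳ++⁻ Bs tB
    with g′ , R′ , rm , tR′ ← make-room tR g x∈ y∉ =
    exchange (Remove-++ʳ P rm) (Remove-insert R′) (converge Bs ((x , y) ∷ P) R′ tR′ tB lR′ lB len′)
    where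
      lR′ : length (R′ ++ (x , y) ∷ P) ≡ k
      lR′ = trans (length-++-sucʳ R′ (x , y) P) (trans (sym (Remove-length (Remove-++ʳ P rm))) lR)
      len′ : length R′ ≡ length Bs
      len′ = suc-injective (trans (sym (Remove-length rm)) len)

  arborescence⇝arborescence : ∀ {r as bs} (ta : Arborescence r as) (tb : Arborescence r bs)
                              (la : length as ≡ k) (lb : length bs ≡ k) →
                              arborescence ta la ⇝ arborescence tb lb
  arborescence⇝arborescence {r} {as} {bs} ta tb la lb =
    ⇝-respˡ (≡⇒≈ (sym (++-identityʳ as)))
      (⇝-trans (converge (bs ʳ++ []) [] as ta′ tb′ la′ lb′ len) [ ≡⇒≈ bs′≡bs ])
    where
      bs′≡bs : (bs ʳ++ []) ʳ++ [] ≡ bs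
      bs′≡bs = trans (ʳ++-ʳ++ bs) (++-identityʳ bs)
      ta′ : Arborescence r (as ++ [])
      ta′ = subst (Arborescence r) (sym (++-identityʳ as)) ta
      tb′ : Arborescence r ((bs ʳ++ []) ʳ++ [])
      tb′ = subst (Arborescence r) (sym bs′≡bs) tb
      la′ : length (as ++ []) ≡ k
      la′ = trans (cong length (++-identityʳ as)) la
      lb′ : length ((bs ʳ++ []) ʳ++ []) ≡ k
      lb′ = trans (cong length bs′≡bs) lb
      len : length as ≡ length (bs ʳ++ [])
      len = trans la (trans (sym lb) (sym (trans (length-ʳ++ bs) (+-identityʳ (length bs)))))

  KTree⇝arborescence : ∀ {bs} (X : KTree) (tb : Arborescence (root (sub X)) bs) (lb : length bs ≡ k) →
                       X ⇝ arborescence tb lb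
  KTree⇝arborescence X tb lb with as , ta , as⊆ , ⊆as ← DirectedTreeIn⇒Arborescence (sub X) (treeIn X) =
    ⇝-respˡ (⊆as , as⊆) (arborescence⇝arborescence ta tb la lb)
    where
      la = trans (⊆-antisym⇒length-≡ (arcs-unique ta) (KTree-unique X) as⊆ ⊆as) (size X)

  reconfiguration-via-shared-subtree :
    (T T′ : KTree) → root (sub T) ≢ root (sub T′) →
    (S : SubDigraph n) → DirectedTreeAvoiding G (root (sub T)) (root (sub T′)) S →
    Arc G (root (sub T)) (root S) → Arc G (root (sub T′)) (root S) → suc (length (arcs S)) ≡ k →
    Reconfiguration (sub T) (sub T′)
  reconfiguration-via-shared-subtree T T′ u≢v S avoid uw vw lS
    with s , ts , s⊆ , ⊆s ← DirectedTreeIn⇒Arborescence S (DirectedTreeAvoiding.treeInG avoid) =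
    ⇝-step-⇝⇒reconfiguration
      (KTree⇝arborescence T (extend-root ts (avoid-u ∘ s-inside) uw) (length-snoc _))
      (exchange-arc (Remove-insert s) (Remove-insert s) (u≢v ∘ cong proj₁))
      (⇝-sym (KTree⇝arborescence T′ (extend-root ts (avoid-v ∘ s-inside) vw) (length-snoc _)))
    where
      open DirectedTreeAvoiding avoid
      s-inside : vertices (root S) s ⊆ verts S
      s-inside = vertices⊆verts S treeInG s⊆
      length-snoc : ∀ e → length (s ++ e ∷ []) ≡ k
      length-snoc e = begin
        length (s ++ e ∷ [])   ≡⟨ length-++ s ⟩
        length s + 1           ≡⟨ +-comm (length s) 1 ⟩
        suc (length s)         ≡⟨ cong suc (⊆-antisym⇒length-≡ (arcs-unique ts) S-unique s⊆ ⊆s) ⟩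
        suc (length (arcs S))  ≡⟨ lS ⟩
        k                      ∎
        where
          open ≡-Reasoning
          S-unique = IsDirectedTree.arcs-unique (DirectedTreeIn.isTree treeInG)

lemma2 : ∀ {n : ℕ} (G : Digraph n) (k : ℕ) → 1 ≤ k →
         (u v : Fin n) → u ≢ v →
         (T T′ : SubDigraph n) →
         DirectedTreeIn G T → root T ≡ u → length (arcs T) ≡ k →
         DirectedTreeIn G T′ → root T′ ≡ v → length (arcs T′) ≡ k →
         (∃[ w ] (N⁺ G u w × N⁺ G v w ×
            (∃[ S ] (DirectedTreeAvoiding G u v S × root S ≡ w × length (arcs S) ≡ k ∸ 1)))) →
         ∃[ ℓ ] Σ[ Ts ∈ (Fin (suc ℓ) → SubDigraph n) ]
           ((Ts zero ≡ T) × (Ts (fromℕ ℓ) ≡ T′) ×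
            (∀ i → DirectedTreeIn G (Ts i) × length (arcs (Ts i)) ≡ k) ×
            (∀ (i : Fin ℓ) → length (arcDiff (Ts (inject₁ i)) (Ts (suc i))) ≡ 1
                           × length (arcDiff (Ts (suc i)) (Ts (inject₁ i))) ≡ 1))
lemma2 G (suc k) (s≤s z≤n) _ _ u≢v T T′ D refl lT D′ refl lT′ (_ , uw , vw , S , avoid , refl , lS) =
  reconfiguration-via-shared-subtree (record { sub = T ; treeIn = D ; size = lT })
    (record { sub = T′ ; treeIn = D′ ; size = lT′ }) u≢v S avoid uw vw (cong suc lS)
  where open Reconfiguration G (suc k)
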